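{- Let $G$ be a $4$-regular graph on nine vertices which contains neither the diamond graph nor $K_4$ as a (not necessarily induced) subgraph. Then either the vertex set of $G$ can be partitioned into three sets each inducing a triangle, or $G$ is isomorphic to the graph $\Gamma^{(1)}$.
   Context: All graphs are finite and simple. The diamond graph is $K_4$ minus one edge (four vertices, five edges). The graph $\Gamma^{(1)}$ has vertex set $\{x,a,b,c,d,e,f,g,h\}$ and edge set $\{xe,xf,xg,xh,\ ab,bc,\ de,df,dg,dh,\ ea,eb,\ fb,fc,\ ga,gc,\ ha,hc\}$ (it is $4$-regular with $18$ edges). -}

module Defs where

open import Data.Nat using (ℕ; suc)
open import Data.Bool using (Bool; true; false; T)
open import Data.Fin using (Fin; zero; suc)
open import Data.Fin.Patterns
open import Data.List using (List; filter; length; allFin)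
open import Data.Product using (Σ; _×_; _,_)
open import Relation.Nullary using (¬_)
open import Relation.Binary.PropositionalEquality using (_≡_)
open import Function.Bundles using (_↔_; Inverse)
open import Function.Definitions using (Injective)
open import Data.Bool using (_≟_)

record Graph (n : ℕ) : Set where
  field
    adj   : Fin n → Fin n → Bool
    sym   : ∀ u v → adj u v ≡ adj v u
    irrefl : ∀ v → adj v v ≡ false
open Graph public

Adj : ∀ {n} → Graph n → Fin n → Fin n → Set
Adj G u v = T (adj G u v)

degree : ∀ {n} → Graph n → Fin n → ℕ
degree {n} G v = length (filter (λ u → adj G v u ≟ true) (allFin n))

Regular : ∀ {n} → ℕ → Graph n → Set
Regular k G = ∀ v → degree G v ≡ k

SubgraphOf : ∀ {m n} → Graph m → Graph n → Set
SubgraphOf {m} {n} H G =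
  Σ (Fin m → Fin n) λ f → Injective _≡_ _≡_ f × (∀ u v → Adj H u v → Adj G (f u) (f v))

Isomorphic : ∀ {m n} → Graph m → Graph n → Set
Isomorphic {m} {n} G H =
  Σ (Fin m ↔ Fin n) λ φ → ∀ u v → adj G u v ≡ adj H (Inverse.to φ u) (Inverse.to φ v)

k4adj : Fin 4 → Fin 4 → Bool
k4adj 0F 0F = false
k4adj 1F 1F = false
k4adj 2F 2F = false
k4adj 3F 3F = false
k4adj _ _ = true

K4 : Graph 4
K4 = record { adj = k4adj ; sym = s ; irrefl = i }
  where
  s : ∀ u v → k4adj u v ≡ k4adj v u
  s 0F 0F = _≡_.refl
  s 0F 1F = _≡_.refl
  s 0F 2F = _≡_.refl
  s 0F 3F = _≡_.refl
  s 1F 0F = _≡_.refl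
  s 1F 1F = _≡_.refl
  s 1F 2F = _≡_.refl
  s 1F 3F = _≡_.refl
  s 2F 0F = _≡_.refl
  s 2F 1F = _≡_.refl
  s 2F 2F = _≡_.refl
  s 2F 3F = _≡_.refl
  s 3F 0F = _≡_.refl
  s 3F 1F = _≡_.refl
  s 3F 2F = _≡_.refl
  s 3F 3F = _≡_.refl
  i : ∀ v → k4adj v v ≡ false
  i 0F = _≡_.refl
  i 1F = _≡_.refl
  i 2F = _≡_.refl
  i 3F = _≡_.refl

dadj : Fin 4 → Fin 4 → Bool
dadj 2F 3F = false
dadj 3F 2F = false
dadj u v = k4adj u v

Diamond : Graph 4
Diamond = record { adj = dadj ; sym = s ; irrefl = i }
  where
  s : ∀ u v → dadj u v ≡ dadj v u
  s 0F 0F = _≡_.refl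
  s 0F 1F = _≡_.refl
  s 0F 2F = _≡_.refl
  s 0F 3F = _≡_.refl
  s 1F 0F = _≡_.refl
  s 1F 1F = _≡_.refl
  s 1F 2F = _≡_.refl
  s 1F 3F = _≡_.refl
  s 2F 0F = _≡_.refl
  s 2F 1F = _≡_.refl
  s 2F 2F = _≡_.refl
  s 2F 3F = _≡_.refl
  s 3F 0F = _≡_.refl
  s 3F 1F = _≡_.refl
  s 3F 2F = _≡_.refl
  s 3F 3F = _≡_.refl
  i : ∀ v → dadj v v ≡ false
  i 0F = _≡_.refl
  i 1F = _≡_.refl
  i 2F = _≡_.refl
  i 3F = _≡_.refl

-- Γ⁽¹⁾ with vertices x,a,b,c,d,e,f,g,h numbered 0..8
-- edges: xe xf xg xh ab bc de df dg dh ea eb fb fc ga gc ha hc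
edge : Fin 9 → Fin 9 → Bool
edge 0F 5F = true
edge 0F 6F = true
edge 0F 7F = true
edge 0F 8F = true
edge 1F 2F = true
edge 2F 3F = true
edge 4F 5F = true
edge 4F 6F = true
edge 4F 7F = true
edge 4F 8F = true
edge 5F 1F = true
edge 5F 2F = true
edge 6F 2F = true
edge 6F 3F = true
edge 7F 1F = true
edge 7F 3F = true
edge 8F 1F = true
edge 8F 3F = true
edge _ _ = false

Γ1adj : Fin 9 → Fin 9 → Bool
Γ1adj u v = edge u v Data.Bool.∨ edge v u

Γ1 : Graph 9
Γ1 = record { adj = Γ1adj ; sym = s ; irrefl = i }
  where
  open import Data.Bool.Properties using (∨-comm)
  s : ∀ u v → Γ1adj u v ≡ Γ1adj v u
  s u v = ∨-comm (edge u v) (edge v u)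
  i : ∀ v → Γ1adj v v ≡ false
  i 0F = _≡_.refl
  i 1F = _≡_.refl
  i 2F = _≡_.refl
  i 3F = _≡_.refl
  i 4F = _≡_.refl
  i 5F = _≡_.refl
  i 6F = _≡_.refl
  i 7F = _≡_.refl
  i 8F = _≡_.refl

-- Partition of the vertex set into three triangles: a bijection
-- σ : Fin 3 × Fin 3 ↔ Fin n (the block i is {σ(i,0),σ(i,1),σ(i,2)})
-- such that distinct vertices in a common block are adjacent.
TrianglePartition : ∀ {n} → Graph n → Set
TrianglePartition {n} G =
  Σ ((Fin 3 × Fin 3) ↔ Fin n) λ σ →
    ∀ i j k → ¬ (j ≡ k) → Adj G (Inverse.to σ (i , j)) (Inverse.to σ (i , k))

{-# OPTIONS --safe #-}
-- After relabelling, vertex 0 is adjacent exactly to 5, 6, 7, 8. The remaining pairs of vertices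
-- are then decided one at a time, and a branch dies as soon as the newly added edge lies in a
-- diamond, or a vertex whose neighbourhood is fully decided has degree other than 4. Every
-- complete graph that survives carries a certificate, checked by evaluation: three disjoint
-- triangles, or an explicit isomorphism onto Γ1.
module Submission where

open import Defs
open import Data.Bool using (Bool; true; false; T; _∧_; _∨_; not; if_then_else_)
import Data.Bool as Bool
open import Data.Bool.Properties using (T-∧; T-∨; T-≡)
open import Data.Empty using (⊥-elim)
open import Data.Fin using (Fin; zero; suc; _≟_; combine)
open import Data.Fin.Patterns
open import Data.Fin.Permutation using (Permutation′; permutation; _⟨$⟩ʳ_; _⟨$⟩ˡ_; inverseʳ)
open import Data.Fin.Properties using (all?; *↔×)
open import Data.Fin.Subset.Properties using (anySubset?)
open import Data.List using (List; []; _∷_; _++_; map; concatMap; cartesianProduct; allFin; filter; filterᵇ; findᵇ; length)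
import Data.List as List
open import Data.List.Membership.DecPropositional {A = Fin 9} _≟_ using (_∈?_)
open import Data.List.Relation.Unary.Any using (Any; any?; satisfied)
open import Data.Maybe using (Maybe; just; nothing; fromMaybe)
import Data.Maybe as Maybe
open import Data.Maybe.Properties using (just-injective)
import Data.Maybe.Properties as Maybeₚ
open import Data.Maybe.Relation.Unary.Any using () renaming (Any to AnyMaybe)
import Data.Maybe.Relation.Unary.Any as AnyMaybe
open import Data.Nat using (ℕ; _+_)
import Data.Nat as ℕ
open import Data.Nat.Properties using (+-0-commutativeMonoid)
open import Algebra.Properties.CommutativeMonoid.Sum +-0-commutativeMonoid
  using (sum; sum-permute; sum-cong-≗)
open import Data.Product using (Σ; _×_; _,_; proj₁; proj₂; uncurry)
import Data.Product.Properties as Productₚ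
open import Data.Sum using (_⊎_; inj₁; inj₂; [_,_]′)
import Data.Sum as Sum
open import Data.Vec using (Vec; []; _∷_; lookup; tabulate; _[_]≔_)
open import Data.Vec.Properties using (lookup∘update; lookup∘update′; lookup∘tabulate)
open import Function using (_∘_; id)
open import Function.Bundles using (Equivalence; Inverse; Injection)
open import Function.Construct.Composition using (_↔-∘_)
open import Function.Construct.Symmetry using (↔-sym)
open import Function.Definitions using (Injective)
open import Function.Properties.Inverse using (↔⇒↣)
open import Relation.Binary.PropositionalEquality using (_≡_; _≢_; refl; cong; cong₂; trans; subst)
import Relation.Binary.PropositionalEquality as ≡
open import Relation.Nullary using (¬_; Dec; yes; no; ¬?; _×-dec_; _⊎-dec_; _→-dec_)
open import Relation.Nullary.Decidable using (⌊_⌋; T?; toWitness; decidable-stable)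

dec-false⇒¬ : ∀ {A : Set} (a? : Dec A) → ⌊ a? ⌋ ≡ false → ¬ A
dec-false⇒¬ (yes _)  ()
dec-false⇒¬ (no ¬a) _ = ¬a

T-∧-select : ∀ (f : Bool → Bool) b → T (f true ∧ f false) → T (f b)
T-∧-select f true  = proj₁ ∘ Equivalence.to (T-∧ {f true})
T-∧-select f false = proj₂ ∘ Equivalence.to (T-∧ {f true})

pairsOf : ∀ {A : Set} → List A → List (A × A)
pairsOf []       = []
pairsOf (x ∷ xs) = map (x ,_) xs ++ pairsOf xs

triplesOf : ∀ {A : Set} → List A → List (A × A × A)
triplesOf []       = []
triplesOf (x ∷ xs) = map (x ,_) (pairsOf xs) ++ triplesOf xs

orderings : ∀ {A : Set} → List A → List (A × A)
orderings (u ∷ v ∷ []) = (u , v) ∷ (v , u) ∷ []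
orderings _            = []

padTo : ∀ {A : Set} m → A → List A → Vec A m
padTo ℕ.zero    _ _        = []
padTo (ℕ.suc m) a []       = a ∷ padTo m a []
padTo (ℕ.suc m) a (x ∷ xs) = x ∷ padTo m a xs

indicator : Bool → ℕ
indicator true  = 1
indicator false = 0

count : ∀ {n} → (Fin n → Bool) → ℕ
count p = sum (indicator ∘ p)

count-cong : ∀ {n} {p q : Fin n → Bool} → (∀ x → p x ≡ q x) → count p ≡ count q
count-cong p≗q = sum-cong-≗ (cong indicator ∘ p≗q)

count-permute : ∀ {n} (p : Fin n → Bool) (π : Permutation′ n) → count (p ∘ (π ⟨$⟩ʳ_)) ≡ count p
count-permute p π = ≡.sym (sum-permute (indicator ∘ p) π)

length-filter-tabulate : ∀ {m n} (p : Fin m → Bool) (g : Fin n → Fin m) →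
  length (filter (λ u → p u Bool.≟ true) (List.tabulate g)) ≡ count (p ∘ g)
length-filter-tabulate {n = ℕ.zero}  p g = refl
length-filter-tabulate {n = ℕ.suc n} p g with p (g zero)
... | true  = cong ℕ.suc (length-filter-tabulate p (g ∘ suc))
... | false = length-filter-tabulate p (g ∘ suc)

degree≡count : ∀ {n} (G : Graph n) v → degree G v ≡ count (adj G v)
degree≡count G v = length-filter-tabulate (adj G v) id

adjacent-distinct : ∀ {n} (G : Graph n) {u v} → Adj G u v → u ≢ v
adjacent-distinct G {u} uv refl = subst T (Graph.irrefl G u) uv

adjacent-sym : ∀ {n} (G : Graph n) {u v} → Adj G u v → Adj G v u
adjacent-sym G {u} {v} = subst T (Graph.sym G u v)

diamondOn : ∀ {n} (G : Graph n) {p q r s} → r ≢ s →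
  Adj G p q → Adj G p r → Adj G p s → Adj G q r → Adj G q s → SubgraphOf Diamond G
diamondOn {n} G {p} {q} {r} {s} r≢s pq pr ps qr qs = f , injective , edges
  where
  f : Fin 4 → Fin n
  f 0F = p
  f 1F = q
  f 2F = r
  f 3F = s
  edges : ∀ u v → Adj Diamond u v → Adj G (f u) (f v)
  edges 0F 1F _ = pq
  edges 0F 2F _ = pr
  edges 0F 3F _ = ps
  edges 1F 2F _ = qr
  edges 1F 3F _ = qs
  edges 1F 0F _ = adjacent-sym G pq
  edges 2F 0F _ = adjacent-sym G pr
  edges 3F 0F _ = adjacent-sym G ps
  edges 2F 1F _ = adjacent-sym G qr
  edges 3F 1F _ = adjacent-sym G qs
  edges 0F 0F ()
  edges 1F 1F ()
  edges 2F 2F ()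
  edges 3F 3F ()
  edges 2F 3F ()
  edges 3F 2F ()
  injective : Injective _≡_ _≡_ f
  injective {0F} {0F} _ = refl
  injective {1F} {1F} _ = refl
  injective {2F} {2F} _ = refl
  injective {3F} {3F} _ = refl
  injective {2F} {3F} e = ⊥-elim (r≢s e)
  injective {3F} {2F} e = ⊥-elim (r≢s (≡.sym e))
  injective {0F} {1F} e = ⊥-elim (adjacent-distinct G pq e)
  injective {0F} {2F} e = ⊥-elim (adjacent-distinct G pr e)
  injective {0F} {3F} e = ⊥-elim (adjacent-distinct G ps e)
  injective {1F} {2F} e = ⊥-elim (adjacent-distinct G qr e)
  injective {1F} {3F} e = ⊥-elim (adjacent-distinct G qs e)
  injective {1F} {0F} e = ⊥-elim (adjacent-distinct G pq (≡.sym e))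
  injective {2F} {0F} e = ⊥-elim (adjacent-distinct G pr (≡.sym e))
  injective {3F} {0F} e = ⊥-elim (adjacent-distinct G ps (≡.sym e))
  injective {2F} {1F} e = ⊥-elim (adjacent-distinct G qr (≡.sym e))
  injective {3F} {1F} e = ⊥-elim (adjacent-distinct G qs (≡.sym e))

-- Relabelling along a permutation

relabel : ∀ {n} → Graph n → Permutation′ n → Graph n
relabel G π = record
  { adj    = λ u v → adj G (π ⟨$⟩ʳ u) (π ⟨$⟩ʳ v)
  ; sym    = λ u v → Graph.sym G (π ⟨$⟩ʳ u) (π ⟨$⟩ʳ v)
  ; irrefl = λ v → Graph.irrefl G (π ⟨$⟩ʳ v)
  }

module _ {n} (G : Graph n) (π : Permutation′ n) where

  relabel-regular : ∀ {k} → Regular k G → Regular k (relabel G π)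
  relabel-regular {k} regular v = begin
    degree (relabel G π) v                ≡⟨ degree≡count (relabel G π) v ⟩
    count (adj G (π ⟨$⟩ʳ v) ∘ (π ⟨$⟩ʳ_))  ≡⟨ count-permute (adj G (π ⟨$⟩ʳ v)) π ⟩
    count (adj G (π ⟨$⟩ʳ v))              ≡⟨ degree≡count G (π ⟨$⟩ʳ v) ⟨
    degree G (π ⟨$⟩ʳ v)                   ≡⟨ regular (π ⟨$⟩ʳ v) ⟩
    k                                     ∎
    where open ≡.≡-Reasoning

  relabel-free : ∀ {m} {H : Graph m} → ¬ SubgraphOf H G → ¬ SubgraphOf H (relabel G π)
  relabel-free H⊈G (f , f-injective , f-edges) =
    H⊈G ((π ⟨$⟩ʳ_) ∘ f , f-injective ∘ Injection.injective (↔⇒↣ π) , f-edges)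

  relabel-trianglePartition : TrianglePartition (relabel G π) → TrianglePartition G
  relabel-trianglePartition (σ , blocks) = π ↔-∘ σ , blocks

  relabel-isomorphic : ∀ {m} {K : Graph m} → Isomorphic (relabel G π) K → Isomorphic G K
  relabel-isomorphic {K = K} (φ , φ-adj) = φ ↔-∘ ↔-sym π , λ u v → begin
    adj G u v                                                 ≡⟨ cong₂ (adj G) (inverseʳ π) (inverseʳ π) ⟨
    adj G (π ⟨$⟩ʳ (π ⟨$⟩ˡ u)) (π ⟨$⟩ʳ (π ⟨$⟩ˡ v))             ≡⟨ φ-adj (π ⟨$⟩ˡ u) (π ⟨$⟩ˡ v) ⟩
    adj K (Inverse.to φ (π ⟨$⟩ˡ u)) (Inverse.to φ (π ⟨$⟩ˡ v)) ∎
    where open ≡.≡-Reasoning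

Table : ℕ → Set
Table n = Vec (Fin n) n

inverseTable : ∀ {n} → Table n → Table n
inverseTable t = tabulate λ y → fromMaybe y (findᵇ (λ x → ⌊ lookup t x ≟ y ⌋) (allFin _))

IsPermutationTable : ∀ {n} → Table n → Set
IsPermutationTable t =
  (∀ x → lookup (inverseTable t) (lookup t x) ≡ x) × (∀ y → lookup t (lookup (inverseTable t) y) ≡ y)

isPermutationTable? : ∀ {n} (t : Table n) → Dec (IsPermutationTable t)
isPermutationTable? t = all? (λ x → lookup (inverseTable t) (lookup t x) ≟ x)
                 ×-dec all? (λ y → lookup t (lookup (inverseTable t) y) ≟ y)

tablePermutation : ∀ {n} (t : Table n) → IsPermutationTable t → Permutation′ n
tablePermutation t (left , right) = permutation (lookup t) (lookup (inverseTable t)) right left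

-- Partial adjacency matrices

Partial : ℕ → Set
Partial n = Vec (Vec (Maybe Bool) n) n

entry : ∀ {n} → Partial n → Fin n → Fin n → Maybe Bool
entry S u v = lookup (lookup S u) v

record Agrees {n} (G : Graph n) (S : Partial n) : Set where
  constructor agreeing
  field agree : ∀ u v {b} → entry S u v ≡ just b → adj G u v ≡ b
open Agrees

assign : ∀ {n} → Partial n → Fin n → Fin n → Bool → Partial n
assign S u v b = S [ u ]≔ (lookup S u [ v ]≔ just b)

decide : ∀ {n} → Partial n → Fin n → Fin n → Bool → Partial n
decide S u v b = assign (assign S v u b) u v b

edge? : ∀ {n} → Partial n → Fin n → Fin n → Bool
edge? S u v = fromMaybe false (entry S u v)

module _ {n} {S : Partial n} {u v : Fin n} {b : Bool} where
  open ≡.≡-Reasoning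

  entry-assign : entry (assign S u v b) u v ≡ just b
  entry-assign = begin
    lookup (lookup (assign S u v b) u) v  ≡⟨ cong (λ row → lookup row v) (lookup∘update u S _) ⟩
    lookup (lookup S u [ v ]≔ just b) v   ≡⟨ lookup∘update v (lookup S u) _ ⟩
    just b                                ∎

  entry-assign-other : ∀ {x y} → (u , v) ≢ (x , y) → entry (assign S u v b) x y ≡ entry S x y
  entry-assign-other {x} {y} uv≢xy with u ≟ x
  ... | no u≢x   = cong (λ row → lookup row y) (lookup∘update′ (u≢x ∘ ≡.sym) S _)
  ... | yes refl = begin
    lookup (lookup (assign S u v b) u) y  ≡⟨ cong (λ row → lookup row y) (lookup∘update u S _) ⟩
    lookup (lookup S u [ v ]≔ just b) y   ≡⟨ lookup∘update′ y≢v (lookup S u) _ ⟩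
    lookup (lookup S u) y                 ∎
    where
    y≢v : y ≢ v
    y≢v y≡v = uv≢xy (cong (u ,_) (≡.sym y≡v))

module _ {n} {G : Graph n} where

  agrees-assign : ∀ {S u v b} → Agrees G S → adj G u v ≡ b → Agrees G (assign S u v b)
  agrees-assign {S} {u} {v} {b} agrees uv≡b = agreeing known
    where
    known : ∀ x y {c} → entry (assign S u v b) x y ≡ just c → adj G x y ≡ c
    known x y eq with Productₚ.≡-dec _≟_ _≟_ (u , v) (x , y)
    ... | yes refl = trans uv≡b (just-injective (trans (≡.sym (entry-assign {S = S} {u} {v} {b})) eq))
    ... | no uv≢xy = agree agrees x y (trans (≡.sym (entry-assign-other {S = S} {b = b} uv≢xy)) eq)

  agrees-decide : ∀ {S u v b} → Agrees G S → adj G u v ≡ b → Agrees G (decide S u v b)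
  agrees-decide {u = u} {v} agrees uv≡b =
    agrees-assign (agrees-assign agrees (trans (Graph.sym G v u) uv≡b)) uv≡b

  agrees-edge : ∀ {S} → Agrees G S → ∀ u v → T (edge? S u v) → Adj G u v
  agrees-edge {S} agrees u v uv = subst T (≡.sym (agree agrees u v (just-true (entry S u v) uv))) _
    where
    just-true : ∀ m → T (fromMaybe false m) → m ≡ just true
    just-true (just true) _ = refl

decidedDegree : ∀ {n} → Vec (Maybe Bool) n → Maybe ℕ
decidedDegree []             = just 0
decidedDegree (nothing ∷ _)  = nothing
decidedDegree (just b ∷ row) = Maybe.map (indicator b +_) (decidedDegree row)

decidedDegree-sound : ∀ {n} (row : Vec (Maybe Bool) n) (p : Fin n → Bool) →
  (∀ u {b} → lookup row u ≡ just b → p u ≡ b) → ∀ {d} → decidedDegree row ≡ just d → count p ≡ d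
decidedDegree-sound [] p _ refl = refl
decidedDegree-sound (just b ∷ row) p agrees eq with decidedDegree row in eq′
decidedDegree-sound (just b ∷ row) p agrees refl | just d =
  cong₂ _+_ (cong indicator (agrees zero refl)) (decidedDegree-sound row (p ∘ suc) (agrees ∘ suc) eq′)

DegreeMismatch : ∀ {n} → ℕ → Vec (Maybe Bool) n → Set
DegreeMismatch k row = AnyMaybe (_≢ k) (decidedDegree row)

degreeMismatch? : ∀ {n} k (row : Vec (Maybe Bool) n) → Dec (DegreeMismatch k row)
degreeMismatch? k row = AnyMaybe.dec (λ d → ¬? (d ℕ.≟ k)) (decidedDegree row)

degreeMismatch-impossible : ∀ {n k} {G : Graph n} {S} → Regular k G → Agrees G S →
  ∀ v → ¬ DegreeMismatch k (lookup S v)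
degreeMismatch-impossible {S = S} regular agrees v mismatch with decidedDegree (lookup S v) in eq
degreeMismatch-impossible {k = k} {G} {S} regular agrees v (AnyMaybe.just d≢k) | just d = d≢k (begin
  d                ≡⟨ decidedDegree-sound (lookup S v) (adj G v) (agree agrees v) eq ⟨
  count (adj G v)  ≡⟨ degree≡count G v ⟨
  degree G v       ≡⟨ regular v ⟩
  k                ∎)
  where open ≡.≡-Reasoning

-- Checkable refutations and certificates

Triple : ℕ → Set
Triple n = Fin n × Fin n × Fin n

Quadruple : ℕ → Set
Quadruple n = Fin n × Fin n × Fin n × Fin n

IsDiamond : ∀ {n} → Partial n → Quadruple n → Set
IsDiamond S (p , q , r , s) =
  r ≢ s × T (edge? S p q) × T (edge? S p r) × T (edge? S p s) × T (edge? S q r) × T (edge? S q s)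

isDiamond? : ∀ {n} (S : Partial n) w → Dec (IsDiamond S w)
isDiamond? S (p , q , r , s) = ¬? (r ≟ s) ×-dec T? _ ×-dec T? _ ×-dec T? _ ×-dec T? _ ×-dec T? _

diamond-sound : ∀ {n} {G : Graph n} {S} → Agrees G S → ∀ w → IsDiamond S w → SubgraphOf Diamond G
diamond-sound {G = G} {S} agrees (p , q , r , s) (r≢s , pq , pr , ps , qr , qs) =
  diamondOn G r≢s (known pq) (known pr) (known ps) (known qr) (known qs)
  where
  known : ∀ {u v} → T (edge? S u v) → Adj G u v
  known = agrees-edge agrees _ _

commonNeighbours : ∀ {n} → Partial n → Fin n → Fin n → List (Fin n)
commonNeighbours S u v = filterᵇ (λ w → edge? S u w ∧ edge? S v w) (allFin _)

-- A diamond containing the edge ij either has spine ij, or lies on a triangle ijk and has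
-- spine ik or jk.
diamondsThrough : ∀ {n} → Partial n → Fin n → Fin n → List (Quadruple n)
diamondsThrough S i j = concatMap candidates (commonNeighbours S i j)
  where
  candidates : Fin _ → List (Quadruple _)
  candidates k = map (λ l → i , j , k , l) (commonNeighbours S i j)
              ++ map (λ l → i , k , j , l) (commonNeighbours S i k)
              ++ map (λ l → j , k , i , l) (commonNeighbours S j k)

Refutation : ∀ {n} → ℕ → Partial n → Fin n → Fin n → Bool → Set
Refutation k S i j b = (T b × Any (IsDiamond S) (diamondsThrough S i j))
                     ⊎ DegreeMismatch k (lookup S i) ⊎ DegreeMismatch k (lookup S j)

refutation? : ∀ {n} k (S : Partial n) i j b → Dec (Refutation k S i j b)
refutation? k S i j b = (T? b ×-dec any? (isDiamond? S) _)
                  ⊎-dec degreeMismatch? k (lookup S i) ⊎-dec degreeMismatch? k (lookup S j)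

refutation-impossible : ∀ {n k} {G : Graph n} {S} → Regular k G → ¬ SubgraphOf Diamond G → Agrees G S →
  ∀ i j {b} → ¬ Refutation k S i j b
refutation-impossible _ diamondFree agrees i j (inj₁ (_ , diamond)) =
  diamondFree (uncurry (diamond-sound agrees) (satisfied diamond))
refutation-impossible regular _ agrees i j (inj₂ (inj₁ mismatch)) = degreeMismatch-impossible regular agrees i mismatch
refutation-impossible regular _ agrees i j (inj₂ (inj₂ mismatch)) = degreeMismatch-impossible regular agrees j mismatch

triangles : ∀ {n} → Partial n → List (Triple n)
triangles S = filterᵇ (λ (a , b , c) → edge? S a b ∧ edge? S a c ∧ edge? S b c) (triplesOf (allFin _))

IsTrianglePartitionTable : Partial 9 → Table 9 → Set
IsTrianglePartitionTable S t = IsPermutationTable t ×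
  (∀ (i j k : Fin 3) → j ≡ k ⊎ T (edge? S (lookup t (combine i j)) (lookup t (combine i k))))

isTrianglePartitionTable? : ∀ S t → Dec (IsTrianglePartitionTable S t)
isTrianglePartitionTable? S t =
  isPermutationTable? t ×-dec all? λ i → all? λ j → all? λ k → (j ≟ k) ⊎-dec T? _

trianglePartition-sound : ∀ {G S} → Agrees G S → ∀ t → IsTrianglePartitionTable S t → TrianglePartition G
trianglePartition-sound {G} agrees t (perm , blocks) =
  tablePermutation t perm ↔-∘ ↔-sym (*↔× {3} {3}) , adjacent
  where
  adjacent : ∀ (i j k : Fin 3) → j ≢ k → Adj G (lookup t (combine i j)) (lookup t (combine i k))
  adjacent i j k j≢k = [ ⊥-elim ∘ j≢k , agrees-edge agrees _ _ ]′ (blocks i j k)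

tripleTable : Triple 9 × Triple 9 × Triple 9 → Table 9
tripleTable ((a , b , c) , (d , e , f) , (g , h , i)) = a ∷ b ∷ c ∷ d ∷ e ∷ f ∷ g ∷ h ∷ i ∷ []

IsIsomorphismTable : ∀ {n} → Partial n → Graph n → Table n → Set
IsIsomorphismTable S K ψ =
  IsPermutationTable ψ × (∀ u v → entry S (lookup ψ u) (lookup ψ v) ≡ just (adj K u v))

isIsomorphismTable? : ∀ {n} S (K : Graph n) ψ → Dec (IsIsomorphismTable S K ψ)
isIsomorphismTable? S K ψ =
  isPermutationTable? ψ ×-dec all? λ u → all? λ v → Maybeₚ.≡-dec Bool._≟_ (entry S _ _) (just (adj K u v))

isomorphism-sound : ∀ {n} {G K : Graph n} {S} → Agrees G S → ∀ ψ → IsIsomorphismTable S K ψ → Isomorphic G K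
isomorphism-sound {G = G} {K} agrees ψ (perm , matches) = ↔-sym ψ̂ , λ u v → begin
  adj G u v                                      ≡⟨ cong₂ (adj G) (inverseʳ ψ̂) (inverseʳ ψ̂) ⟨
  adj G (ψ̂ ⟨$⟩ʳ (ψ̂ ⟨$⟩ˡ u)) (ψ̂ ⟨$⟩ʳ (ψ̂ ⟨$⟩ˡ v))  ≡⟨ agree agrees _ _ (matches (ψ̂ ⟨$⟩ˡ u) (ψ̂ ⟨$⟩ˡ v)) ⟩
  adj K (ψ̂ ⟨$⟩ˡ u) (ψ̂ ⟨$⟩ˡ v)                    ∎
  where
  ψ̂ = tablePermutation ψ perm
  open ≡.≡-Reasoning

-- Γ1 has exactly two triangles, eab and fbc, meeting in b. Swapping x ↔ d, g ↔ h or
-- (a , e) ↔ (c , f) is an automorphism, so only the order within the pairs {a , e} and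
-- {c , f} needs to be guessed; x and d are the two other neighbours of e.
Γ1-labellings : Partial 9 → List (Table 9)
Γ1-labellings S with triangles S
... | t ∷ t′ ∷ [] = concatMap (λ b → concatMap (labelling b) (cartesianProduct (around t b) (around t′ b)))
                              (allFin 9)
  where
  around : Triple 9 → Fin 9 → List (Fin 9 × Fin 9)
  around (u , v , w) b = orderings (filterᵇ (λ x → not ⌊ x ≟ b ⌋) (u ∷ v ∷ w ∷ []))
  labelling : Fin 9 → (Fin 9 × Fin 9) × (Fin 9 × Fin 9) → List (Table 9)
  labelling b ((a , e) , (c , f))
    with filterᵇ (edge? S e) rest | filterᵇ (not ∘ edge? S e) rest
    where rest = filterᵇ (λ v → not ⌊ v ∈? a ∷ b ∷ c ∷ e ∷ f ∷ [] ⌋) (allFin 9)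
  ... | x ∷ d ∷ [] | g ∷ h ∷ [] = (x ∷ a ∷ b ∷ c ∷ d ∷ e ∷ f ∷ g ∷ h ∷ []) ∷ []
  ... | _          | _          = []
... | _ = []

Certificate : Partial 9 → Set
Certificate S = Any (IsTrianglePartitionTable S) (map tripleTable (triplesOf (triangles S)))
              ⊎ Any (IsIsomorphismTable S Γ1) (Γ1-labellings S)

certificate? : ∀ S → Dec (Certificate S)
certificate? S = any? (isTrianglePartitionTable? S) _ ⊎-dec any? (isIsomorphismTable? S Γ1) _

certificate-sound : ∀ {G S} → Agrees G S → Certificate S → TrianglePartition G ⊎ Isomorphic G Γ1
certificate-sound agrees (inj₁ partition) =
  inj₁ (uncurry (trianglePartition-sound agrees) (satisfied partition))
certificate-sound agrees (inj₂ isomorphism) =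
  inj₂ (uncurry (isomorphism-sound {K = Γ1} agrees) (satisfied isomorphism))

-- The exhaustive search

mutual
  explore : List (Fin 9 × Fin 9) → Partial 9 → Bool
  explore []             S = ⌊ certificate? S ⌋
  explore ((i , j) ∷ ps) S = exploreBranch ps S i j true ∧ exploreBranch ps S i j false

  exploreBranch : List (Fin 9 × Fin 9) → Partial 9 → Fin 9 → Fin 9 → Bool → Bool
  exploreBranch ps S i j b = ⌊ refutation? 4 (decide S i j b) i j b ⌋ ∨ explore ps (decide S i j b)

-- Success is an equation rather than T (explore ps S): Agda evaluates a closed T-type far
-- more slowly than it checks refl.
explore-sound : ∀ {G : Graph 9} → Regular 4 G → ¬ SubgraphOf Diamond G →
  ∀ ps {S} → Agrees G S → explore ps S ≡ true → TrianglePartition G ⊎ Isomorphic G Γ1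
explore-sound regular diamondFree [] agrees certified =
  certificate-sound agrees (toWitness (Equivalence.from T-≡ certified))
explore-sound {G} regular diamondFree ((i , j) ∷ ps) {S} agrees both
  with Equivalence.to (T-∨ {⌊ refutation? 4 (decide S i j (adj G i j)) i j (adj G i j) ⌋})
                      (T-∧-select (exploreBranch ps S i j) (adj G i j) (Equivalence.from T-≡ both))
... | inj₁ refuted  =
  ⊥-elim (refutation-impossible regular diamondFree (agrees-decide agrees refl) i j (toWitness refuted))
... | inj₂ explored =
  explore-sound regular diamondFree ps (agrees-decide agrees refl) (Equivalence.to T-≡ explored)

-- As in Γ1, whose vertex x = 0 has neighbours e, f, g, h = 5, 6, 7, 8.
normalNeighbours : Fin 9 → Bool
normalNeighbours 5F = true
normalNeighbours 6F = true
normalNeighbours 7F = true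
normalNeighbours 8F = true
normalNeighbours _  = false

initialEntry : Fin 9 → Fin 9 → Maybe Bool
initialEntry zero    v       = just (normalNeighbours v)
initialEntry (suc u) zero    = just (normalNeighbours (suc u))
initialEntry (suc u) (suc v) = if ⌊ u ≟ v ⌋ then just false else nothing

initial : Partial 9
initial = tabulate λ u → tabulate (initialEntry u)

agrees-initial : ∀ {G : Graph 9} → (∀ v → adj G 0F v ≡ normalNeighbours v) → Agrees G initial
agrees-initial {G} neighbours = agreeing λ u v eq → known u v (trans (≡.sym (entry-initial u v)) eq)
  where
  entry-initial : ∀ u v → entry initial u v ≡ initialEntry u v
  entry-initial u v = trans (cong (λ row → lookup row v) (lookup∘tabulate (tabulate ∘ initialEntry) u))
                            (lookup∘tabulate (initialEntry u) v)
  known : ∀ u v {b} → initialEntry u v ≡ just b → adj G u v ≡ b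
  known zero    v       refl = neighbours v
  known (suc u) zero    refl = trans (Graph.sym G (suc u) zero) (neighbours (suc u))
  known (suc u) (suc v) eq with u ≟ v
  known (suc u) (suc u) refl | yes refl = Graph.irrefl G (suc u)
  known (suc u) (suc v) ()   | no _

decisionOrder : List (Fin 9 × Fin 9)
decisionOrder = pairsOf (map suc (allFin 8))

exploration-succeeds : explore decisionOrder initial ≡ true
exploration-succeeds = refl

classification-normalised : ∀ {G : Graph 9} → Regular 4 G → ¬ SubgraphOf Diamond G →
  (∀ v → adj G 0F v ≡ normalNeighbours v) → TrianglePartition G ⊎ Isomorphic G Γ1
classification-normalised {G} regular diamondFree neighbours =
  explore-sound {G} regular diamondFree decisionOrder {initial} (agrees-initial neighbours) exploration-succeeds

-- Normalising the neighbourhood of vertex 0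

neighboursLast : Vec Bool 9 → Table 9
neighboursLast r = padTo 9 0F (filterᵇ (not ∘ lookup r) (allFin 9) ++ filterᵇ (lookup r) (allFin 9))

NormalisesRow : Vec Bool 9 → Table 9 → Set
NormalisesRow r t =
  IsPermutationTable t × lookup t 0F ≡ 0F × (∀ u → lookup r (lookup t u) ≡ normalNeighbours u)

RowNormalisable : Vec Bool 9 → Set
RowNormalisable r = lookup r 0F ≡ false → count (lookup r) ≡ 4 → NormalisesRow r (neighboursLast r)

rowNormalisable? : ∀ r → Dec (RowNormalisable r)
rowNormalisable? r = lookup r 0F Bool.≟ false →-dec count (lookup r) ℕ.≟ 4 →-dec
  isPermutationTable? t ×-dec lookup t 0F ≟ 0F ×-dec all? (λ u → lookup r (lookup t u) Bool.≟ normalNeighbours u)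
  where t = neighboursLast r

no-unnormalisable-row : ⌊ anySubset? (¬? ∘ rowNormalisable?) ⌋ ≡ false
no-unnormalisable-row = refl

every-row-normalisable : ∀ r → RowNormalisable r
every-row-normalisable r = decidable-stable (rowNormalisable? r) λ ¬normalisable →
  dec-false⇒¬ (anySubset? (¬? ∘ rowNormalisable?)) no-unnormalisable-row (r , ¬normalisable)

normaliseNeighbourhood : (G : Graph 9) → degree G 0F ≡ 4 →
  Σ (Permutation′ 9) λ π → ∀ v → adj (relabel G π) 0F v ≡ normalNeighbours v
normaliseNeighbourhood G degree≡4 = tablePermutation t (proj₁ normalised) , λ v → begin
  adj G (lookup t 0F) (lookup t v)  ≡⟨ cong (λ w → adj G w (lookup t v)) (proj₁ (proj₂ normalised)) ⟩
  adj G 0F (lookup t v)             ≡⟨ lookup∘tabulate (adj G 0F) (lookup t v) ⟨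
  lookup r (lookup t v)             ≡⟨ proj₂ (proj₂ normalised) v ⟩
  normalNeighbours v                ∎
  where
  open ≡.≡-Reasoning
  r = tabulate (adj G 0F)
  t = neighboursLast r
  normalised : NormalisesRow r t
  normalised = every-row-normalisable r
    (trans (lookup∘tabulate (adj G 0F) 0F) (Graph.irrefl G 0F))
    (trans (count-cong (lookup∘tabulate (adj G 0F))) (trans (≡.sym (degree≡count G 0F)) degree≡4))

lemma3p1 : (G : Graph 9) → Regular 4 G → ¬ SubgraphOf Diamond G → ¬ SubgraphOf K4 G →
    TrianglePartition G ⊎ Isomorphic G Γ1
lemma3p1 G regular diamondFree _ = uncurry classify (normaliseNeighbourhood G (regular 0F))
  where
  classify : ∀ π → (∀ v → adj (relabel G π) 0F v ≡ normalNeighbours v) → TrianglePartition G ⊎ Isomorphic G Γ1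
  classify π neighbours =
    Sum.map (relabel-trianglePartition G π) (relabel-isomorphic G π {K = Γ1})
      (classification-normalised {relabel G π} (relabel-regular G π regular) (relabel-free G π {H = Diamond} diamondFree)
        neighbours)
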